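{- If $\kappa$ is countably infinite, then $\mathcal{S}$ (with the lattice operations inherited from $M_3[\mathcal{F}(\kappa)]$) is a countable bounded modular lattice.
   Context: Let $\kappa$ be an infinite cardinal, identified with the set of ordinals less than $\kappa$. Let $\mathcal{F}(\kappa)=\{X\subseteq\kappa : X \text{ is finite or } \kappa\setminus X \text{ is finite}\}$. For subsets $A,B,C\subseteq\kappa$ put $\mu\langle A,B,C\rangle=(A\cap B)\cup(A\cap C)\cup(B\cap C)$ and $\overline{\langle A,B,C\rangle}=\langle A\cup\mu,\ B\cup\mu,\ C\cup\mu\rangle$ with $\mu=\mu\langle A,B,C\rangle$. A triple $\langle A,B,C\rangle$ is balanced if $A\cap B=A\cap C=B\cap C$. $M_3[\mathcal{F}(\kappa)]$ is the set of balanced triples in $\mathcal{F}(\kappa)^3$, ordered componentwise; it is a lattice with meet the componentwise intersection and join $\langle A,B,C\rangle\vee\langle A',B',C'\rangle=\overline{\langle A\cup A',B\cup B',C\cup C'\rangle}$. Let $\mathcal{T}=\{\langle A,B,C\rangle\in\mathcal{F}(\kappa)^3 : C\setminus\mu\langle A,B,C\rangle \text{ is finite}\}$ and $\mathcal{S}=\mathcal{T}\cap M_3[\mathcal{F}(\kappa)]$. -}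

module Defs where

open import Data.Nat using (ℕ)
open import Data.Bool using (Bool; true; false; _∧_; _∨_; not)
open import Data.List using (List)
open import Data.List.Membership.Propositional using (_∈_)
open import Data.Product using (Σ; _×_; _,_; proj₁; proj₂)
open import Data.Sum using (_⊎_)
open import Relation.Binary.PropositionalEquality using (_≡_)
open import Algebra.Core using (Op₂)
open import Algebra.Lattice.Structures using (IsLattice)

-- κ = ω (the countably infinite cardinal), identified with ℕ.
-- A subset of κ is represented by its (decidable) characteristic function.
Sub : Set
Sub = ℕ → Bool

_≐_ : Sub → Sub → Set
X ≐ Y = ∀ n → X n ≡ Y n

_∩_ : Sub → Sub → Sub
(X ∩ Y) n = X n ∧ Y n

_∪_ : Sub → Sub → Sub
(X ∪ Y) n = X n ∨ Y n

_∖_ : Sub → Sub → Sub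
(X ∖ Y) n = X n ∧ not (Y n)

∅ : Sub
∅ _ = false

full : Sub
full _ = true

compl : Sub → Sub
compl X n = not (X n)

Finite : Sub → Set
Finite X = Σ (List ℕ) λ xs → ∀ n → X n ≡ true → n ∈ xs

InF : Sub → Set
InF X = Finite X ⊎ Finite (compl X)

Tri : Set
Tri = Sub × Sub × Sub

fst snd thd : Tri → Sub
fst (A , _ , _) = A
snd (_ , B , _) = B
thd (_ , _ , C) = C

μ : Tri → Sub
μ (A , B , C) = (A ∩ B) ∪ ((A ∩ C) ∪ (B ∩ C))

closure : Tri → Tri
closure t = (fst t ∪ μ t) , (snd t ∪ μ t) , (thd t ∪ μ t)

Balanced : Tri → Set
Balanced (A , B , C) = ((A ∩ B) ≐ (A ∩ C)) × ((A ∩ C) ≐ (B ∩ C))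

InF³ : Tri → Set
InF³ (A , B , C) = InF A × InF B × InF C

InM3 : Tri → Set
InM3 t = InF³ t × Balanced t

InT : Tri → Set
InT t = InF³ t × Finite (thd t ∖ μ t)

InS : Tri → Set
InS t = InT t × InM3 t

_⊓_ : Tri → Tri → Tri
(A , B , C) ⊓ (A' , B' , C') = (A ∩ A') , (B ∩ B') , (C ∩ C')

_⊔_ : Tri → Tri → Tri
(A , B , C) ⊔ (A' , B' , C') = closure ((A ∪ A') , (B ∪ B') , (C ∪ C'))

𝓢 : Set
𝓢 = Σ Tri InS

_≈ₛ_ : 𝓢 → 𝓢 → Set
x ≈ₛ y = (fst (proj₁ x) ≐ fst (proj₁ y)) × (snd (proj₁ x) ≐ snd (proj₁ y))
           × (thd (proj₁ x) ≐ thd (proj₁ y))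

record IsModularLattice {A : Set} (_≈_ : A → A → Set) (join meet : Op₂ A) : Set where
  field
    isLattice : IsLattice _≈_ join meet
    modular   : ∀ x y z → meet x z ≈ x → join x (meet y z) ≈ meet (join x y) z

IsBounded : {A : Set} (_≈_ : A → A → Set) (join meet : Op₂ A) (⊥ ⊤ : A) → Set
IsBounded _≈_ join meet ⊥ ⊤ = ∀ x → (meet ⊥ x ≈ ⊥) × (meet x ⊤ ≈ x)

Countable : {A : Set} (_≈_ : A → A → Set) → Set
Countable {A} _≈_ = Σ (A → ℕ) λ f → (∀ x y → x ≈ y → f x ≡ f y) × (∀ x y → f x ≡ f y → x ≈ y)

-- At each point n of ω a balanced triple ⟨A,B,C⟩ gives a balanced triple of bits,
-- and the balanced bit triples 000, 100, 010, 001, 111 are the five elements of the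
-- diamond M₃, on which ⊓ and ⊔ act as its meet and join.  So ⊓ and ⊔ on balanced
-- triples are computed pointwise in M₃, and the lattice laws and modularity hold
-- because they hold in the finite modular lattice M₃.  Membership in 𝓢 is preserved:
-- 𝓕(ω) is closed under ∩ and ∪, and a point of C ∖ μ of a meet or a join is such a
-- point of one of the arguments.  For countability, a finite set is coded by the
-- binary number its characteristic function spells below a bound, a cofinite set by
-- the code of its complement, and a triple by pairing the three codes.
module Submission where

open import Defs
open import Data.Product using (Σ; _×_; proj₁)
open import Relation.Binary.PropositionalEquality using (_≡_)
open import Algebra.Core using (Op₂)

open import Algebra.Lattice.Structures using (IsLattice)
open import Data.Bool using (Bool; true; false; _∧_; _∨_; not)
open import Data.Bool.Properties
  using (_≟_; ∧-conicalˡ; ∧-conicalʳ; ∧-identityʳ; ¬-not; not-injective; ∨-∧-booleanAlgebra)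
open import Algebra.Lattice.Properties.BooleanAlgebra ∨-∧-booleanAlgebra
  using (deMorgan₁; deMorgan₂)
open import Data.Empty using (⊥; ⊥-elim)
open import Data.List using ([]; _++_)
open import Data.List.Extrema.Nat using (max; xs≤max)
open import Data.List.Membership.Propositional.Properties using (∈-++⁺ˡ; ∈-++⁺ʳ)
open import Data.List.Relation.Unary.All as All using ()
open import Data.Nat using (ℕ; zero; suc; _+_; _*_; _≤_; _<_; z≤n; s≤s; s≤s⁻¹; _<?_)
open import Data.Nat.Properties
  using (≤-trans; <⇒≱; ≮⇒≥; m≤m+n; m≤n+m; +-comm; *-cancelˡ-≡; suc-injective; even≢odd)
open import Data.Product using (_,_; proj₂)
open import Data.Product.Properties using (≡-dec)
open import Data.Sum using (_⊎_; inj₁; inj₂; [_,_]′)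
open import Function using (_∘_)
open import Relation.Binary.Definitions using (DecidableEquality)
open import Relation.Binary.PropositionalEquality
  using (refl; sym; trans; cong; cong₂; module ≡-Reasoning)
open import Relation.Binary.Structures using (IsEquivalence)
open import Relation.Nullary.Decidable
  using (Dec; yes; no; map′; _×-dec_; _⊎-dec_; _→-dec_; from-yes)

Bool³ : Set
Bool³ = Bool × Bool × Bool

infix  4 _≟³_
infixr 6 _⊓³_
infixr 5 _⊔³_ _∪³_

_≟³_ : DecidableEquality Bool³
_≟³_ = ≡-dec _≟_ (≡-dec _≟_ _≟_)

∀-Bool? : {P : Bool → Set} → (∀ b → Dec (P b)) → Dec (∀ b → P b)
∀-Bool? P? = map′ (λ (f , t) → λ { false → f ; true → t }) (λ h → h false , h true)
  (P? false ×-dec P? true)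

∀-Bool³? : {P : Bool³ → Set} → (∀ p → Dec (P p)) → Dec (∀ p → P p)
∀-Bool³? P? = map′ (λ h (a , b , c) → h a b c) (λ h a b c → h (a , b , c))
  (∀-Bool? λ a → ∀-Bool? λ b → ∀-Bool? λ c → P? (a , b , c))

IsBalanced³ : Bool³ → Set
IsBalanced³ (a , b , c) = (a ∧ b ≡ a ∧ c) × (a ∧ c ≡ b ∧ c)

isBalanced³? : ∀ p → Dec (IsBalanced³ p)
isBalanced³? (a , b , c) = (a ∧ b ≟ a ∧ c) ×-dec (a ∧ c ≟ b ∧ c)

_⊓³_ _∪³_ : Bool³ → Bool³ → Bool³
(a , b , c) ⊓³ (a' , b' , c') = a ∧ a' , b ∧ b' , c ∧ c'
(a , b , c) ∪³ (a' , b' , c') = a ∨ a' , b ∨ b' , c ∨ c'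

μ³ : Bool³ → Bool
μ³ (a , b , c) = (a ∧ b) ∨ ((a ∧ c) ∨ (b ∧ c))

closure³ : Bool³ → Bool³
closure³ p@(a , b , c) = a ∨ μ³ p , b ∨ μ³ p , c ∨ μ³ p

_⊔³_ : Bool³ → Bool³ → Bool³
p ⊔³ q = closure³ (p ∪³ q)

c∖μ³ : Bool³ → Bool
c∖μ³ p@(_ , _ , c) = c ∧ not (μ³ p)

⊔³-comm : ∀ p q → p ⊔³ q ≡ q ⊔³ p
⊔³-comm = from-yes (∀-Bool³? λ p → ∀-Bool³? λ q → p ⊔³ q ≟³ q ⊔³ p)

⊓³-comm : ∀ p q → p ⊓³ q ≡ q ⊓³ p
⊓³-comm = from-yes (∀-Bool³? λ p → ∀-Bool³? λ q → p ⊓³ q ≟³ q ⊓³ p)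

⊔³-assoc : ∀ p q r → (p ⊔³ q) ⊔³ r ≡ p ⊔³ (q ⊔³ r)
⊔³-assoc = from-yes (∀-Bool³? λ p → ∀-Bool³? λ q → ∀-Bool³? λ r →
  (p ⊔³ q) ⊔³ r ≟³ p ⊔³ (q ⊔³ r))

⊓³-assoc : ∀ p q r → (p ⊓³ q) ⊓³ r ≡ p ⊓³ (q ⊓³ r)
⊓³-assoc = from-yes (∀-Bool³? λ p → ∀-Bool³? λ q → ∀-Bool³? λ r →
  (p ⊓³ q) ⊓³ r ≟³ p ⊓³ (q ⊓³ r))

⊔³-absorbs-⊓³ : ∀ p q → IsBalanced³ p → p ⊔³ (p ⊓³ q) ≡ p
⊔³-absorbs-⊓³ = from-yes (∀-Bool³? λ p → ∀-Bool³? λ q →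
  isBalanced³? p →-dec p ⊔³ (p ⊓³ q) ≟³ p)

⊓³-absorbs-⊔³ : ∀ p q → p ⊓³ (p ⊔³ q) ≡ p
⊓³-absorbs-⊔³ = from-yes (∀-Bool³? λ p → ∀-Bool³? λ q → p ⊓³ (p ⊔³ q) ≟³ p)

⊔³-modular : ∀ p q r → IsBalanced³ q → IsBalanced³ r →
             p ⊓³ r ≡ p → p ⊔³ (q ⊓³ r) ≡ (p ⊔³ q) ⊓³ r
⊔³-modular = from-yes (∀-Bool³? λ p → ∀-Bool³? λ q → ∀-Bool³? λ r →
  isBalanced³? q →-dec isBalanced³? r →-dec
  (p ⊓³ r ≟³ p) →-dec (p ⊔³ (q ⊓³ r) ≟³ (p ⊔³ q) ⊓³ r))

⊓³-balanced : ∀ p q → IsBalanced³ p → IsBalanced³ q → IsBalanced³ (p ⊓³ q)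
⊓³-balanced = from-yes (∀-Bool³? λ p → ∀-Bool³? λ q →
  isBalanced³? p →-dec isBalanced³? q →-dec isBalanced³? (p ⊓³ q))

⊔³-balanced : ∀ p q → IsBalanced³ (p ⊔³ q)
⊔³-balanced = from-yes (∀-Bool³? λ p → ∀-Bool³? λ q → isBalanced³? (p ⊔³ q))

c∖μ³-⊓³ : ∀ p q → IsBalanced³ p → c∖μ³ (p ⊓³ q) ≡ true → c∖μ³ p ≡ true ⊎ c∖μ³ q ≡ true
c∖μ³-⊓³ = from-yes (∀-Bool³? λ p → ∀-Bool³? λ q → isBalanced³? p →-dec
  (c∖μ³ (p ⊓³ q) ≟ true) →-dec ((c∖μ³ p ≟ true) ⊎-dec (c∖μ³ q ≟ true)))

c∖μ³-⊔³ : ∀ p q → c∖μ³ (p ⊔³ q) ≡ true → c∖μ³ p ≡ true ⊎ c∖μ³ q ≡ true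
c∖μ³-⊔³ = from-yes (∀-Bool³? λ p → ∀-Bool³? λ q →
  (c∖μ³ (p ⊔³ q) ≟ true) →-dec ((c∖μ³ p ≟ true) ⊎-dec (c∖μ³ q ≟ true)))

∨≡true⇒⊎ : ∀ a b → a ∨ b ≡ true → a ≡ true ⊎ b ≡ true
∨≡true⇒⊎ true  _ _ = inj₁ refl
∨≡true⇒⊎ false _ h = inj₂ h

finite-⊆ : {X Z : Sub} → (∀ n → Z n ≡ true → X n ≡ true) → Finite X → Finite Z
finite-⊆ Z⊆X (xs , X⊆xs) = xs , λ n Zn → X⊆xs n (Z⊆X n Zn)

finite-⊆-∪ : {X Y Z : Sub} → (∀ n → Z n ≡ true → X n ≡ true ⊎ Y n ≡ true) →
             Finite X → Finite Y → Finite Z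
finite-⊆-∪ Z⊆X∪Y (xs , X⊆xs) (ys , Y⊆ys) =
  xs ++ ys , λ n Zn → [ ∈-++⁺ˡ ∘ X⊆xs n , ∈-++⁺ʳ xs ∘ Y⊆ys n ]′ (Z⊆X∪Y n Zn)

finite-∅ : Finite ∅
finite-∅ = [] , λ _ ()

compl-∩-⊆ : (X Y : Sub) → ∀ n → compl (X ∩ Y) n ≡ true → compl X n ≡ true ⊎ compl Y n ≡ true
compl-∩-⊆ X Y n h = ∨≡true⇒⊎ (not (X n)) (not (Y n)) (trans (sym (deMorgan₁ (X n) (Y n))) h)

compl-∪-⊆ : (X Y : Sub) → ∀ n → compl (X ∪ Y) n ≡ true → (compl X ∩ compl Y) n ≡ true
compl-∪-⊆ X Y n = trans (sym (deMorgan₂ (X n) (Y n)))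

InF-∩ : {X Y : Sub} → InF X → InF Y → InF (X ∩ Y)
InF-∩ {X} {Y} (inj₁ X-fin) _ = inj₁ (finite-⊆ (λ n → ∧-conicalˡ (X n) (Y n)) X-fin)
InF-∩ {X} {Y} (inj₂ _) (inj₁ Y-fin) = inj₁ (finite-⊆ (λ n → ∧-conicalʳ (X n) (Y n)) Y-fin)
InF-∩ {X} {Y} (inj₂ X-cof) (inj₂ Y-cof) = inj₂ (finite-⊆-∪ (compl-∩-⊆ X Y) X-cof Y-cof)

InF-∪ : {X Y : Sub} → InF X → InF Y → InF (X ∪ Y)
InF-∪ {X} {Y} (inj₁ X-fin) (inj₁ Y-fin) =
  inj₁ (finite-⊆-∪ (λ n → ∨≡true⇒⊎ (X n) (Y n)) X-fin Y-fin)
InF-∪ {X} {Y} (inj₂ X-cof) _ =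
  inj₂ (finite-⊆ (λ n → ∧-conicalˡ (compl X n) (compl Y n) ∘ compl-∪-⊆ X Y n) X-cof)
InF-∪ {X} {Y} (inj₁ _) (inj₂ Y-cof) =
  inj₂ (finite-⊆ (λ n → ∧-conicalʳ (compl X n) (compl Y n) ∘ compl-∪-⊆ X Y n) Y-cof)

InF-μ : (t : Tri) → InF³ t → InF (μ t)
InF-μ _ (A , B , C) = InF-∪ (InF-∩ A B) (InF-∪ (InF-∩ A C) (InF-∩ B C))

InF³-closure : (t : Tri) → InF³ t → InF³ (closure t)
InF³-closure t F@(A , B , C) = InF-∪ A (InF-μ t F) , InF-∪ B (InF-μ t F) , InF-∪ C (InF-μ t F)

InF³-⊓ : (s t : Tri) → InF³ s → InF³ t → InF³ (s ⊓ t)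
InF³-⊓ _ _ (A , B , C) (A' , B' , C') = InF-∩ A A' , InF-∩ B B' , InF-∩ C C'

InF³-⊔ : (s t : Tri) → InF³ s → InF³ t → InF³ (s ⊔ t)
InF³-⊔ (_ , _ , _) (_ , _ , _) (A , B , C) (A' , B' , C') =
  InF³-closure _ (InF-∪ A A' , InF-∪ B B' , InF-∪ C C')

_at_ : Tri → ℕ → Bool³
t at n = fst t n , snd t n , thd t n

_atₛ_ : 𝓢 → ℕ → Bool³
x atₛ n = proj₁ x at n

balanced-at : (x : 𝓢) → ∀ n → IsBalanced³ (x atₛ n)
balanced-at (_ , _ , _ , AB≐AC , AC≐BC) n = AB≐AC n , AC≐BC n

balanced-from-at : (t : Tri) → (∀ n → IsBalanced³ (t at n)) → Balanced t
balanced-from-at _ bal = proj₁ ∘ bal , proj₂ ∘ bal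

at-≡⇒≈ₛ : (x y : 𝓢) → (∀ n → x atₛ n ≡ y atₛ n) → x ≈ₛ y
at-≡⇒≈ₛ _ _ eq = cong proj₁ ∘ eq , cong (proj₁ ∘ proj₂) ∘ eq , cong (proj₂ ∘ proj₂) ∘ eq

≈ₛ⇒at-≡ : (x y : 𝓢) → x ≈ₛ y → ∀ n → x atₛ n ≡ y atₛ n
≈ₛ⇒at-≡ _ _ (A≐ , B≐ , C≐) n = cong₂ _,_ (A≐ n) (cong₂ _,_ (B≐ n) (C≐ n))

inS : (t : Tri) → InF³ t → Finite (thd t ∖ μ t) → Balanced t → InS t
inS _ F fin bal = (F , fin) , F , bal

⊓-closed : (x y : 𝓢) → InS (proj₁ x ⊓ proj₁ y)
⊓-closed x@(s , (Fs , fins) , _) y@(t , (Ft , fint) , _) =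
  inS (s ⊓ t) (InF³-⊓ s t Fs Ft)
    (finite-⊆-∪ (λ n → c∖μ³-⊓³ (s at n) (t at n) (balanced-at x n)) fins fint)
    (balanced-from-at (s ⊓ t) λ n →
      ⊓³-balanced (s at n) (t at n) (balanced-at x n) (balanced-at y n))

⊔-closed : (x y : 𝓢) → InS (proj₁ x ⊔ proj₁ y)
⊔-closed (s , (Fs , fins) , _) (t , (Ft , fint) , _) =
  inS (s ⊔ t) (InF³-⊔ s t Fs Ft)
    (finite-⊆-∪ (λ n → c∖μ³-⊔³ (s at n) (t at n)) fins fint)
    (balanced-from-at (s ⊔ t) λ n → ⊔³-balanced (s at n) (t at n))

_∧ₛ_ : Op₂ 𝓢
x ∧ₛ y = proj₁ x ⊓ proj₁ y , ⊓-closed x y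

_∨ₛ_ : Op₂ 𝓢
x ∨ₛ y = proj₁ x ⊔ proj₁ y , ⊔-closed x y

≈ₛ-isEquivalence : IsEquivalence _≈ₛ_
≈ₛ-isEquivalence = record
  { refl  = λ {x} → at-≡⇒≈ₛ x x λ _ → refl
  ; sym   = λ {x} {y} x≈y → at-≡⇒≈ₛ y x (sym ∘ ≈ₛ⇒at-≡ x y x≈y)
  ; trans = λ {x} {y} {z} x≈y y≈z → at-≡⇒≈ₛ x z λ n →
              trans (≈ₛ⇒at-≡ x y x≈y n) (≈ₛ⇒at-≡ y z y≈z n)
  }

isLattice : IsLattice _≈ₛ_ _∨ₛ_ _∧ₛ_
isLattice = record
  { isEquivalence = ≈ₛ-isEquivalence
  ; ∨-comm     = λ x y → at-≡⇒≈ₛ (x ∨ₛ y) (y ∨ₛ x) λ n → ⊔³-comm (x atₛ n) (y atₛ n)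
  ; ∨-assoc    = λ x y z → at-≡⇒≈ₛ ((x ∨ₛ y) ∨ₛ z) (x ∨ₛ (y ∨ₛ z)) λ n →
                   ⊔³-assoc (x atₛ n) (y atₛ n) (z atₛ n)
  ; ∨-cong     = λ {x} {y} {u} {v} x≈y u≈v → at-≡⇒≈ₛ (x ∨ₛ u) (y ∨ₛ v) λ n →
                   cong₂ _⊔³_ (≈ₛ⇒at-≡ x y x≈y n) (≈ₛ⇒at-≡ u v u≈v n)
  ; ∧-comm     = λ x y → at-≡⇒≈ₛ (x ∧ₛ y) (y ∧ₛ x) λ n → ⊓³-comm (x atₛ n) (y atₛ n)
  ; ∧-assoc    = λ x y z → at-≡⇒≈ₛ ((x ∧ₛ y) ∧ₛ z) (x ∧ₛ (y ∧ₛ z)) λ n →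
                   ⊓³-assoc (x atₛ n) (y atₛ n) (z atₛ n)
  ; ∧-cong     = λ {x} {y} {u} {v} x≈y u≈v → at-≡⇒≈ₛ (x ∧ₛ u) (y ∧ₛ v) λ n →
                   cong₂ _⊓³_ (≈ₛ⇒at-≡ x y x≈y n) (≈ₛ⇒at-≡ u v u≈v n)
  ; absorptive =
      (λ x y → at-≡⇒≈ₛ (x ∨ₛ (x ∧ₛ y)) x λ n →
        ⊔³-absorbs-⊓³ (x atₛ n) (y atₛ n) (balanced-at x n)) ,
      (λ x y → at-≡⇒≈ₛ (x ∧ₛ (x ∨ₛ y)) x λ n → ⊓³-absorbs-⊔³ (x atₛ n) (y atₛ n))
  }

isModularLattice : IsModularLattice _≈ₛ_ _∨ₛ_ _∧ₛ_
isModularLattice = record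
  { isLattice = isLattice
  ; modular   = λ x y z x∧z≈x → at-≡⇒≈ₛ (x ∨ₛ (y ∧ₛ z)) ((x ∨ₛ y) ∧ₛ z) λ n →
      ⊔³-modular (x atₛ n) (y atₛ n) (z atₛ n) (balanced-at y n) (balanced-at z n)
        (≈ₛ⇒at-≡ (x ∧ₛ z) x x∧z≈x n)
  }

⊥ₛ : 𝓢
⊥ₛ = (∅ , ∅ , ∅) , inS _ (∅∈𝓕 , ∅∈𝓕 , ∅∈𝓕) finite-∅ ((λ _ → refl) , (λ _ → refl))
  where
  ∅∈𝓕 : InF ∅
  ∅∈𝓕 = inj₁ finite-∅

-- Both compl full and full ∖ μ compute to ∅.
⊤ₛ : 𝓢
⊤ₛ = (full , full , full) , inS _ (full∈𝓕 , full∈𝓕 , full∈𝓕) finite-∅ ((λ _ → refl) , (λ _ → refl))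
  where
  full∈𝓕 : InF full
  full∈𝓕 = inj₂ finite-∅

isBounded : IsBounded _≈ₛ_ _∨ₛ_ _∧ₛ_ ⊥ₛ ⊤ₛ
isBounded _ = ((λ _ → refl) , (λ _ → refl) , (λ _ → refl))
            , ((λ _ → ∧-identityʳ _) , (λ _ → ∧-identityʳ _) , (λ _ → ∧-identityʳ _))

bit : Bool → ℕ
bit false = 0
bit true  = 1

consBit : Bool → ℕ → ℕ
consBit a m = bit a + 2 * m

consBit-injective : ∀ a b m n → consBit a m ≡ consBit b n → a ≡ b × m ≡ n
consBit-injective false false m n eq = refl , *-cancelˡ-≡ m n 2 eq
consBit-injective true  true  m n eq = refl , *-cancelˡ-≡ m n 2 (suc-injective eq)
consBit-injective false true  m n eq = ⊥-elim (even≢odd m n eq)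
consBit-injective true  false m n eq = ⊥-elim (even≢odd n m (sym eq))

-- pair a b = 2ᵃ (2b + 1)
pair : ℕ → ℕ → ℕ
pair zero    b = consBit true b
pair (suc a) b = consBit false (pair a b)

pair-injective : ∀ a b c d → pair a b ≡ pair c d → a ≡ c × b ≡ d
pair-injective zero    b zero    d eq = refl , proj₂ (consBit-injective true true b d eq)
pair-injective zero    b (suc c) d eq with () ← proj₁ (consBit-injective true false b (pair c d) eq)
pair-injective (suc a) b zero    d eq with () ← proj₁ (consBit-injective false true (pair a b) d eq)
pair-injective (suc a) b (suc c) d eq
  with refl , b≡d ← pair-injective a b c d
                      (proj₂ (consBit-injective false false (pair a b) (pair c d) eq))
  = refl , b≡d

binary : Sub → ℕ → ℕ
binary X zero    = 0
binary X (suc N) = consBit (X 0) (binary (X ∘ suc) N)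

binary-cong : {X Y : Sub} → X ≐ Y → ∀ N → binary X N ≡ binary Y N
binary-cong X≐Y zero    = refl
binary-cong X≐Y (suc N) = cong₂ consBit (X≐Y 0) (binary-cong (X≐Y ∘ suc) N)

binary-suc-injective : (X Y : Sub) (N : ℕ) → binary X (suc N) ≡ binary Y (suc N) →
                       X 0 ≡ Y 0 × binary (X ∘ suc) N ≡ binary (Y ∘ suc) N
binary-suc-injective X Y N = consBit-injective (X 0) (Y 0) (binary (X ∘ suc) N) (binary (Y ∘ suc) N)

binary-injective : (X Y : Sub) (N : ℕ) → binary X N ≡ binary Y N → ∀ n → n < N → X n ≡ Y n
binary-injective X Y (suc N) eq zero    _         = proj₁ (binary-suc-injective X Y N eq)
binary-injective X Y (suc N) eq (suc n) (s≤s n<N) =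
  binary-injective (X ∘ suc) (Y ∘ suc) N (proj₂ (binary-suc-injective X Y N eq)) n n<N

BoundedBy : Sub → ℕ → Set
BoundedBy X N = ∀ n → X n ≡ true → n < N

bounded⇒false : {X : Sub} {N : ℕ} → BoundedBy X N → ∀ n → N ≤ n → X n ≡ false
bounded⇒false X<N n N≤n = ¬-not λ Xn → <⇒≱ (X<N n Xn) N≤n

binary-bounded : {X : Sub} (N k : ℕ) → BoundedBy X N → binary X (N + k) ≡ binary X N
binary-bounded {X} zero k X<0 = binary-∅ X (λ n → bounded⇒false X<0 n z≤n) k
  where
  binary-∅ : (X : Sub) → (∀ n → X n ≡ false) → ∀ k → binary X k ≡ 0
  binary-∅ X X≐∅ zero    = refl
  binary-∅ X X≐∅ (suc k) = cong₂ consBit (X≐∅ 0) (binary-∅ (X ∘ suc) (X≐∅ ∘ suc) k)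
binary-bounded {X} (suc N) k X<N+1 =
  cong (consBit (X 0)) (binary-bounded N k λ n Xn+1 → s≤s⁻¹ (X<N+1 (suc n) Xn+1))

bound : {X : Sub} → Finite X → ℕ
bound (xs , _) = suc (max 0 xs)

bounded-by-bound : {X : Sub} (fin : Finite X) → BoundedBy X (bound fin)
bounded-by-bound (xs , X⊆xs) n Xn = s≤s (All.lookup (xs≤max 0 xs) (X⊆xs n Xn))

finite∧cofinite⇒⊥ : {X : Sub} → Finite X → Finite (compl X) → ⊥
finite∧cofinite⇒⊥ {X} fin cof with X (bound fin + bound cof) in eq
... | true  = <⇒≱ (bounded-by-bound fin _ eq) (m≤m+n (bound fin) (bound cof))
... | false = <⇒≱ (bounded-by-bound cof _ (cong not eq)) (m≤n+m (bound cof) (bound fin))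

codeFinite : (X : Sub) → Finite X → ℕ
codeFinite X fin = binary X (bound fin)

codeFinite-extendˡ : {X : Sub} (fin : Finite X) (k : ℕ) →
                     codeFinite X fin ≡ binary X (bound fin + k)
codeFinite-extendˡ fin k = sym (binary-bounded (bound fin) k (bounded-by-bound fin))

codeFinite-extendʳ : {X : Sub} (fin : Finite X) (k : ℕ) →
                     codeFinite X fin ≡ binary X (k + bound fin)
codeFinite-extendʳ {X} fin k =
  trans (codeFinite-extendˡ fin k) (cong (binary X) (+-comm (bound fin) k))

codeFinite-cong : {X Y : Sub} → X ≐ Y → (f : Finite X) (g : Finite Y) →
                  codeFinite X f ≡ codeFinite Y g
codeFinite-cong {X} {Y} X≐Y f g = begin
  codeFinite X f               ≡⟨ codeFinite-extendˡ f (bound g) ⟩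
  binary X (bound f + bound g) ≡⟨ binary-cong X≐Y (bound f + bound g) ⟩
  binary Y (bound f + bound g) ≡⟨ codeFinite-extendʳ g (bound f) ⟨
  codeFinite Y g               ∎
  where open ≡-Reasoning

codeFinite-injective : {X Y : Sub} (f : Finite X) (g : Finite Y) →
                       codeFinite X f ≡ codeFinite Y g → X ≐ Y
codeFinite-injective {X} {Y} f g eq n with n <? bound f + bound g
... | yes n<N = binary-injective X Y _ eq′ n n<N
  where
  eq′ : binary X (bound f + bound g) ≡ binary Y (bound f + bound g)
  eq′ = trans (sym (codeFinite-extendˡ f (bound g))) (trans eq (codeFinite-extendʳ g (bound f)))
... | no n≮N =
  trans (bounded⇒false (bounded-by-bound f) n f≤n) (sym (bounded⇒false (bounded-by-bound g) n g≤n))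
  where
  f≤n : bound f ≤ n
  f≤n = ≤-trans (m≤m+n (bound f) (bound g)) (≮⇒≥ n≮N)
  g≤n : bound g ≤ n
  g≤n = ≤-trans (m≤n+m (bound g) (bound f)) (≮⇒≥ n≮N)

code𝓕 : (X : Sub) → InF X → ℕ
code𝓕 X (inj₁ fin) = pair 0 (codeFinite X fin)
code𝓕 X (inj₂ cof) = pair 1 (codeFinite (compl X) cof)

code𝓕-cong : {X Y : Sub} → X ≐ Y → (F : InF X) (G : InF Y) → code𝓕 X F ≡ code𝓕 Y G
code𝓕-cong X≐Y (inj₁ f) (inj₁ g) = cong (pair 0) (codeFinite-cong X≐Y f g)
code𝓕-cong X≐Y (inj₂ f) (inj₂ g) = cong (pair 1) (codeFinite-cong (cong not ∘ X≐Y) f g)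
code𝓕-cong X≐Y (inj₁ f) (inj₂ g) =
  ⊥-elim (finite∧cofinite⇒⊥ (finite-⊆ (λ n → trans (X≐Y n)) f) g)
code𝓕-cong X≐Y (inj₂ f) (inj₁ g) =
  ⊥-elim (finite∧cofinite⇒⊥ (finite-⊆ (λ n → trans (sym (X≐Y n))) g) f)

code𝓕-injective : {X Y : Sub} (F : InF X) (G : InF Y) → code𝓕 X F ≡ code𝓕 Y G → X ≐ Y
code𝓕-injective (inj₁ f) (inj₁ g) eq = codeFinite-injective f g (proj₂ (pair-injective 0 _ 0 _ eq))
code𝓕-injective (inj₂ f) (inj₂ g) eq =
  not-injective ∘ codeFinite-injective f g (proj₂ (pair-injective 1 _ 1 _ eq))
code𝓕-injective {X} {Y} (inj₁ f) (inj₂ g) eq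
  with () ← proj₁ (pair-injective 0 (codeFinite X f) 1 (codeFinite (compl Y) g) eq)
code𝓕-injective {X} {Y} (inj₂ f) (inj₁ g) eq
  with () ← proj₁ (pair-injective 1 (codeFinite (compl X) f) 0 (codeFinite Y g) eq)

code : 𝓢 → ℕ
code ((A , B , C) , ((FA , FB , FC) , _) , _) = pair (code𝓕 A FA) (pair (code𝓕 B FB) (code𝓕 C FC))

countable : Countable _≈ₛ_
countable = code , code-cong , code-injective
  where
  code-cong : ∀ x y → x ≈ₛ y → code x ≡ code y
  code-cong (_ , ((FA , FB , FC) , _) , _) (_ , ((GA , GB , GC) , _) , _) (A≐ , B≐ , C≐) =
    cong₂ pair (code𝓕-cong A≐ FA GA) (cong₂ pair (code𝓕-cong B≐ FB GB) (code𝓕-cong C≐ FC GC))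

  code-injective : ∀ x y → code x ≡ code y → x ≈ₛ y
  code-injective (_ , ((FA , FB , FC) , _) , _) (_ , ((GA , GB , GC) , _) , _) eq
    with eqA , eqBC ← pair-injective _ _ _ _ eq
    with eqB , eqC  ← pair-injective _ _ _ _ eqBC
    = code𝓕-injective FA GA eqA , code𝓕-injective FB GB eqB , code𝓕-injective FC GC eqC

corollary3p4 : Σ (Op₂ 𝓢) λ _∧ₛ_ → Σ (Op₂ 𝓢) λ _∨ₛ_ → Σ 𝓢 λ ⊥ₛ → Σ 𝓢 λ ⊤ₛ →
    ((∀ x y → proj₁ (x ∧ₛ y) ≡ (proj₁ x ⊓ proj₁ y))
    × (∀ x y → proj₁ (x ∨ₛ y) ≡ (proj₁ x ⊔ proj₁ y)))
    × IsModularLattice _≈ₛ_ _∨ₛ_ _∧ₛ_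
    × IsBounded _≈ₛ_ _∨ₛ_ _∧ₛ_ ⊥ₛ ⊤ₛ
    × Countable _≈ₛ_
corollary3p4 =
  _∧ₛ_ , _∨ₛ_ , ⊥ₛ , ⊤ₛ , ((λ _ _ → refl) , (λ _ _ → refl))
  , isModularLattice , isBounded , countable
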